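{- Let $b>2$ be an integer such that $b\neq 2^r+1$ for every integer $r$, and let $p$ be the smallest odd prime dividing $b-1$. Then the maximum length $t$ of an arithmetic progression $n,n+2,\dots,n+2(t-1)$ of positive integers all of which are $b$-anti-Niven is $p-1$. Moreover, there exist infinitely many positive integers $n$ such that $n+2j$ is $b$-anti-Niven for all $0\leq j\leq p-2$.
   Context: For a positive integer $n$ with base-$b$ expansion $n=\sum_{j=0}^m a_jb^j$ ($0\leq a_j\leq b-1$), $s_b(n)=\sum_{j=0}^m a_j$. A positive integer $n$ is $b$-anti-Niven if $\gcd(n,s_b(n))=1$. -}

module Defs where

open import Data.Nat using (ℕ; zero; suc; _+_; _/_; _%_)
open import Data.Nat.GCD using (gcd)
open import Relation.Binary.PropositionalEquality using (_≡_)

-- digit sum of n in base b, computed with fuel f (f ≥ number of digits suffices)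
digitSumFuel : ℕ → ℕ → ℕ → ℕ
digitSumFuel zero      f       n = n   -- base 0: junk value, never used (b > 2)
digitSumFuel (suc k)   zero    n = 0
digitSumFuel (suc k)   (suc f) n = n % suc k + digitSumFuel (suc k) f (n / suc k)

-- s_b(n) : sum of base-b digits of n (fuel n is enough for b ≥ 2)
digitSum : ℕ → ℕ → ℕ
digitSum b n = digitSumFuel b n n

-- n is b-anti-Niven iff gcd(n, s_b(n)) = 1  (positivity of n is required separately)
AntiNiven : ℕ → ℕ → Set
AntiNiven b n = gcd n (digitSum b n) ≡ 1

{-# OPTIONS --safe #-}
-- Since b ≡ 1 (mod b - 1), every n satisfies s_b(n) ≡ n (mod p). Among n, n + 2, …, n + 2(p - 1) some
-- term is divisible by the odd prime p, and then so is its digit sum: p terms are impossible.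
-- For p - 1 terms write b - 1 = 2^s w with w odd, put y = b - w + 2j and n + 2j = b^(K+1) + y, whose
-- digit sum is 1 + s_b(y) ≤ b + 1. If b^K is idempotent modulo every d ≤ b + 1 (such K exist,
-- arbitrarily large, by pigeonhole on powers of b), a prime q dividing n + 2j and its digit sum divides
-- b^K (b + y), hence b and y, or b + y. Comparing with the digit sum of the one- or two-digit number y
-- leaves only q = 2 or an odd prime factor of b - 1 dividing j + 1, both excluded since w is odd and
-- every odd prime factor of b - 1 is at least p > j + 1.
module Submission where

open import Defs
open import Data.Nat using (ℕ; _+_; _*_; _∸_; _^_; _≤_; _<_)
open import Data.Nat.Divisibility using (_∣_)
open import Data.Nat.Primality using (Prime)
open import Data.Product using (_×_; ∃-syntax)
open import Relation.Binary.PropositionalEquality using (_≡_; _≢_)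
open import Relation.Nullary using (¬_)

open import Data.Empty using (⊥; ⊥-elim)
import Data.Fin.Base as Fin
import Data.Fin.Properties as Fin
open import Data.List.Base using ([]; _∷_)
open import Data.List.Relation.Unary.All using (_∷_)
open import Data.Nat.Base
open import Data.Nat.Coprimality using (Coprime; coprime⇒gcd≡1)
open import Data.Nat.DivMod
open import Data.Nat.Divisibility
open import Data.Nat.GCD using (gcd; gcd-greatest)
open import Data.Nat.Induction using (<-rec)
open import Data.Nat.ListAction using (product)
open import Data.Nat.Primality
open import Data.Nat.Primality.Factorisation using (factorise)
open import Data.Nat.Properties
open import Data.Nat.Tactic.RingSolver using (solve-∀)
open import Data.Product using (_,_; ∃₂; proj₁; proj₂)
open import Data.Sum using (_⊎_; inj₁; inj₂; [_,_]′; map₁)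
open import Function.Base using (id)
open import Relation.Binary.PropositionalEquality
open import Relation.Nullary using (yes; no; contradiction)

∣m+n∣n⇒∣m : ∀ {d m n} → d ∣ m + n → d ∣ n → d ∣ m
∣m+n∣n⇒∣m {d} {m} {n} d∣m+n = ∣m+n∣m⇒∣n (subst (d ∣_) (+-comm m n) d∣m+n)

even⊎odd : ∀ n → ∃[ a ] (n ≡ 2 * a ⊎ n ≡ suc (2 * a))
even⊎odd zero = 0 , inj₁ refl
even⊎odd (suc n) with even⊎odd n
... | a , inj₁ refl = a , inj₂ refl
... | a , inj₂ refl = suc a , inj₁ (2+2a≡2[1+a] a)
  where
  2+2a≡2[1+a] : ∀ a → suc (suc (2 * a)) ≡ 2 * suc a
  2+2a≡2[1+a] = solve-∀

¬2∣odd : ∀ a → ¬ 2 ∣ suc (2 * a)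
¬2∣odd a 2∣1+2a with ∣1⇒≡1 (∣m+n∣n⇒∣m 2∣1+2a (m∣m*n a))
... | ()

¬2∣⇒odd : ∀ {n} → ¬ 2 ∣ n → ∃[ a ] n ≡ suc (2 * a)
¬2∣⇒odd {n} 2∤n with even⊎odd n
... | a , inj₁ refl = contradiction (m∣m*n a) 2∤n
... | a , inj₂ n≡1+2a = a , n≡1+2a

prime≥2 : ∀ {q} → Prime q → 2 ≤ q
prime≥2 {q} pq = nonTrivial⇒n>1 q {{prime⇒nonTrivial pq}}

prime∤1 : ∀ {q} → Prime q → ¬ q ∣ 1
prime∤1 pq q∣1 = <⇒≱ (prime≥2 pq) (∣⇒≤ q∣1)

prime∣2⇒≡2 : ∀ {q} → Prime q → q ∣ 2 → q ≡ 2
prime∣2⇒≡2 pq q∣2 = ≤-antisym (∣⇒≤ q∣2) (prime≥2 pq)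

prime∣^⇒∣ : ∀ {q} m n → Prime q → q ∣ m ^ n → q ∣ m
prime∣^⇒∣ m zero    pq q∣1   = ⊥-elim (prime∤1 pq q∣1)
prime∣^⇒∣ m (suc n) pq q∣m^n = [ id , prime∣^⇒∣ m n pq ]′ (euclidsLemma m (m ^ n) pq q∣m^n)

prime≢2⇒¬2∣ : ∀ {p} → Prime p → p ≢ 2 → ¬ 2 ∣ p
prime≢2⇒¬2∣ pp p≢2 2∣p = [ (λ ()) , (λ 2≡p → p≢2 (sym 2≡p)) ]′ (prime⇒irreducible pp 2∣p)

∃prime∣ : ∀ {n} → 1 < n → ∃[ q ] Prime q × q ∣ n
∃prime∣ {1} (s≤s ())
∃prime∣ {n@(suc (suc _))} _ with factorise n
... | record { factors = [] ; isFactorisation = () }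
... | record { factors = q ∷ qs ; isFactorisation = n≡∏ ; factorsPrime = pq ∷ _ } =
  q , pq , subst (q ∣_) (sym n≡∏) (m∣m*n (product qs))

noCommonPrime⇒coprime : ∀ {m n} → (∀ {q} → Prime q → q ∣ m → q ∣ n → ⊥) → Coprime m n
noCommonPrime⇒coprime none {zero} (0∣m , 0∣n) =
  ⊥-elim (none prime[2] (∣-trans (2 ∣0) 0∣m) (∣-trans (2 ∣0) 0∣n))
noCommonPrime⇒coprime none {1} _ = refl
noCommonPrime⇒coprime none {suc (suc i)} (i∣m , i∣n) with ∃prime∣ {suc (suc i)} (s≤s (s≤s z≤n))
... | q , pq , q∣i = ⊥-elim (none pq (∣-trans q∣i i∣m) (∣-trans q∣i i∣n))

coprime∧prime∣⇒∤ : ∀ {m n q} → Coprime m n → Prime q → q ∣ m → ¬ q ∣ n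
coprime∧prime∣⇒∤ coprime pq q∣m q∣n = prime∤1 pq (∣-reflexive (coprime (q∣m , q∣n)))

OddDecomposition : ℕ → Set
OddDecomposition n = ∃₂ λ s w → n ≡ 2 ^ s * w × ¬ 2 ∣ w

oddDecomposition : ∀ n → 0 < n → OddDecomposition n
oddDecomposition = <-rec (λ n → 0 < n → OddDecomposition n) decompose
  where
  decompose : ∀ n → (∀ {m} → m < n → 0 < m → OddDecomposition m) → 0 < n → OddDecomposition n
  decompose n rec 0<n with even⊎odd n
  ... | a , inj₂ refl = 0 , suc (2 * a) , sym (+-identityʳ _) , ¬2∣odd a
  ... | suc a , inj₁ refl with rec (m<m+n (suc a) z<s) z<s
  ...   | s , w , 1+a≡2^s*w , 2∤w = suc s , w , trans (cong (2 *_) 1+a≡2^s*w) (sym (*-assoc 2 (2 ^ s) w)) , 2∤w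

oddPrime∣2^s*w⇒∣w : ∀ {q s w} → Prime q → q ≢ 2 → q ∣ 2 ^ s * w → q ∣ w
oddPrime∣2^s*w⇒∣w {s = s} {w} pq q≢2 q∣2^s*w =
  [ (λ q∣2^s → contradiction (prime∣2⇒≡2 pq (prime∣^⇒∣ 2 s pq q∣2^s)) q≢2) , id ]′
    (euclidsLemma (2 ^ s) w pq q∣2^s*w)

odd∣n+2j : ∀ a n → ∃[ j ] j < suc (2 * a) × suc (2 * a) ∣ n + 2 * j
odd∣n+2j a zero = 0 , z<s , _ ∣0
odd∣n+2j a (suc n) with odd∣n+2j a n
... | j , _ , p∣n+2j = (j + a) % p , m%n<n (j + a) p , ∣m+n∣n⇒∣m p∣ (n∣m*n (2 * ((j + a) / p)))
  where
  p : ℕ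
  p = suc (2 * a)
  -- As 1 + 2a = p, moving from n to n + 1 is compensated by moving from j to j + a (mod p).
  shift : ∀ r q → j + a ≡ r + q * p → suc n + 2 * r + 2 * q * p ≡ n + 2 * j + p
  shift r q j+a≡r+qp = begin
    suc n + 2 * r + 2 * q * p ≡⟨ distrib (suc n) r q p ⟩
    suc n + 2 * (r + q * p)   ≡⟨ cong (λ x → suc n + 2 * x) j+a≡r+qp ⟨
    suc n + 2 * (j + a)       ≡⟨ regroup n j a ⟩
    n + 2 * j + p             ∎
    where
    open ≡-Reasoning
    distrib : ∀ x r q p → x + 2 * r + 2 * q * p ≡ x + 2 * (r + q * p)
    distrib = solve-∀
    regroup : ∀ n j a → suc n + 2 * (j + a) ≡ n + 2 * j + suc (2 * a)
    regroup = solve-∀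
  p∣ : p ∣ suc n + 2 * ((j + a) % p) + 2 * ((j + a) / p) * p
  p∣ = subst (p ∣_) (sym (shift ((j + a) % p) ((j + a) / p) (m≡m%n+[m/n]*n (j + a) p)))
         (∣m∣n⇒∣m+n p∣n+2j ∣-refl)

n<m^n : ∀ {m} → 1 < m → ∀ n → n < m ^ n
n<m^n 1<m zero = z<s
n<m^n {m} 1<m (suc n) = ≤-<-trans (n<m^n 1<m n) (^-monoʳ-< m 1<m (n<1+n n))

[1+u]^t≡1+u*w : ∀ u t → ∃[ w ] suc u ^ t ≡ suc (u * w)
[1+u]^t≡1+u*w u zero = 0 , cong suc (sym (*-zeroʳ u))
[1+u]^t≡1+u*w u (suc t) with [1+u]^t≡1+u*w u t
... | w , eq = w + suc (u * w) , trans (cong (suc u *_) eq) (expand u w)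
  where
  expand : ∀ u w → suc u * suc (u * w) ≡ suc (u * (w + suc (u * w)))
  expand = solve-∀

%≡%⇒∣ : ∀ m n d .{{_ : NonZero d}} → m % d ≡ (m + n) % d → d ∣ n
%≡%⇒∣ m n d same =
  ∣m+n∣m⇒∣n (subst (d ∣_) (+-cancelˡ-≡ (m % d) _ _ both) (n∣m*n ((m + n) / d))) (n∣m*n (m / d))
  where
  open ≡-Reasoning
  both : m % d + (m + n) / d * d ≡ m % d + (m / d * d + n)
  both = begin
    m % d + (m + n) / d * d       ≡⟨ cong (_+ (m + n) / d * d) same ⟩
    (m + n) % d + (m + n) / d * d ≡⟨ m≡m%n+[m/n]*n (m + n) d ⟨
    m + n                         ≡⟨ cong (_+ n) (m≡m%n+[m/n]*n m d) ⟩
    m % d + m / d * d + n         ≡⟨ +-assoc (m % d) _ n ⟩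
    m % d + (m / d * d + n)       ∎

powers-mod-collide : ∀ b d .{{_ : NonZero d}} → ∃₂ λ i j → i < j × b ^ i % d ≡ b ^ j % d
powers-mod-collide b d with Fin.pigeonhole (n<1+n d) (λ i → Fin.fromℕ< (m%n<n (b ^ Fin.toℕ i) d))
... | i , j , i<j , same = Fin.toℕ i , Fin.toℕ j , i<j ,
  trans (sym (Fin.toℕ-fromℕ< _)) (trans (cong Fin.toℕ same) (Fin.toℕ-fromℕ< _))

-- d ∣ x * (x ∸ 1) says that x * x ≡ x (mod d). If b ^ i ≡ b ^ (i + P) (mod d), then every b ^ K with
-- P ∣ K and K ≥ i is such an idempotent, since (b ^ P) ^ t ≡ 1 (mod b ^ P ∸ 1).
idempotentPower : ∀ b d .{{_ : NonZero d}} .{{_ : NonZero b}} N → ∃[ K ] N ≤ K × d ∣ b ^ K * (b ^ K ∸ 1)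
idempotentPower b d N with powers-mod-collide b d
... | i , j , i<j , b^i≡b^j = K , N≤K , subst (d ∣_) (sym factor) (∣m⇒∣m*n _ d∣b^i*u)
  where
  open ≡-Reasoning
  P u : ℕ
  P = j ∸ i
  u = b ^ P ∸ 1
  b^P≡1+u : b ^ P ≡ suc u
  b^P≡1+u = sym (m+[n∸m]≡n (m^n>0 b P))
  d∣b^i*u : d ∣ b ^ i * u
  d∣b^i*u = %≡%⇒∣ (b ^ i) (b ^ i * u) d (begin
    b ^ i % d               ≡⟨ b^i≡b^j ⟩
    b ^ j % d               ≡⟨ cong (λ x → b ^ x % d) (m+[n∸m]≡n (<⇒≤ i<j)) ⟨
    b ^ (i + P) % d         ≡⟨ cong (_% d) (^-distribˡ-+-* b i P) ⟩
    b ^ i * b ^ P % d       ≡⟨ cong (λ x → b ^ i * x % d) b^P≡1+u ⟩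
    b ^ i * suc u % d       ≡⟨ cong (_% d) (*-suc (b ^ i) u) ⟩
    (b ^ i + b ^ i * u) % d ∎)
  t K : ℕ
  t = suc (N + i)
  K = P * t
  t≤K : t ≤ K
  t≤K = subst (_≤ K) (*-identityˡ t) (*-monoˡ-≤ t (m<n⇒0<n∸m i<j))
  N≤K : N ≤ K
  N≤K = ≤-trans (≤-trans (m≤m+n N i) (n≤1+n _)) t≤K
  i≤K : i ≤ K
  i≤K = ≤-trans (≤-trans (m≤n+m i N) (n≤1+n _)) t≤K
  w : ℕ
  w = proj₁ ([1+u]^t≡1+u*w u t)
  b^K≡1+u*w : b ^ K ≡ suc (u * w)
  b^K≡1+u*w = begin
    b ^ (P * t)   ≡⟨ ^-*-assoc b P t ⟨
    (b ^ P) ^ t   ≡⟨ cong (_^ t) b^P≡1+u ⟩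
    suc u ^ t     ≡⟨ proj₂ ([1+u]^t≡1+u*w u t) ⟩
    suc (u * w)   ∎
  b^K≡b^i*b^[K∸i] : b ^ K ≡ b ^ i * b ^ (K ∸ i)
  b^K≡b^i*b^[K∸i] = trans (cong (b ^_) (sym (m+[n∸m]≡n i≤K))) (^-distribˡ-+-* b i (K ∸ i))
  factor : b ^ K * (b ^ K ∸ 1) ≡ b ^ i * u * (b ^ (K ∸ i) * w)
  factor = begin
    b ^ K * (b ^ K ∸ 1)             ≡⟨ cong₂ _*_ b^K≡b^i*b^[K∸i] (cong (_∸ 1) b^K≡1+u*w) ⟩
    b ^ i * b ^ (K ∸ i) * (u * w)   ≡⟨ interchange (b ^ i) (b ^ (K ∸ i)) u w ⟩
    b ^ i * u * (b ^ (K ∸ i) * w)   ∎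
    where
    interchange : ∀ x y u w → x * y * (u * w) ≡ x * u * (y * w)
    interchange = solve-∀

idempotentPower≤ : ∀ b m .{{_ : NonZero b}} N →
  ∃[ K ] N ≤ K × (∀ {d} → 0 < d → d ≤ m → d ∣ b ^ K * (b ^ K ∸ 1))
idempotentPower≤ b m N with idempotentPower b (m !) {{m !≢0}} N
... | K , N≤K , m!∣ = K , N≤K , λ {d} 0<d d≤m → ∣-trans (m∣m! 0<d) (∣-trans (m≤n⇒m!∣n! d≤m) m!∣)
  where
  m∣m! : ∀ {m} → 0 < m → m ∣ m !
  m∣m! {suc m} _ = m∣m*n (m !)

∣x[x∸1]∧∣bx+y⇒∣x[b+y] : ∀ {d} x b y → d ∣ x * (x ∸ 1) → d ∣ b * x + y → d ∣ x * (b + y)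
∣x[x∸1]∧∣bx+y⇒∣x[b+y] zero    b y _ _ = _ ∣0
∣x[x∸1]∧∣bx+y⇒∣x[b+y] {d} (suc v) b y d∣x[x∸1] d∣bx+y =
  ∣m+n∣m⇒∣n (subst (d ∣_) (split v b y) (∣n⇒∣m*n (suc v) d∣bx+y)) (∣n⇒∣m*n b d∣x[x∸1])
  where
  split : ∀ v b y → suc v * (b * suc v + y) ≡ b * (suc v * v) + suc v * (b + y)
  split = solve-∀

-- The base is written 2 + k so that digitSum b computes by pattern matching.
module DigitSum (k : ℕ) where

  b : ℕ
  b = 2 + k

  private
    [1+n]/b≤n : ∀ n → suc n / b ≤ n
    [1+n]/b≤n n = <⇒≤pred (m/n<m (suc n) b (s≤s (s≤s z≤n)))

  digitSumFuel-zero : ∀ f → digitSumFuel b f 0 ≡ 0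
  digitSumFuel-zero zero    = refl
  digitSumFuel-zero (suc f) = digitSumFuel-zero f

  digitSumFuel-irrelevant : ∀ {f f′} n → n ≤ f → n ≤ f′ → digitSumFuel b f n ≡ digitSumFuel b f′ n
  digitSumFuel-irrelevant {f} {f′} zero _ _ = trans (digitSumFuel-zero f) (sym (digitSumFuel-zero f′))
  digitSumFuel-irrelevant {suc f} {suc f′} (suc n) (s≤s n≤f) (s≤s n≤f′) =
    cong (suc n % b +_) (digitSumFuel-irrelevant (suc n / b) (≤-trans ([1+n]/b≤n n) n≤f) (≤-trans ([1+n]/b≤n n) n≤f′))

  digitSum-step : ∀ n → digitSum b n ≡ n % b + digitSum b (n / b)
  digitSum-step zero    = refl
  digitSum-step (suc n) = cong (suc n % b +_) (digitSumFuel-irrelevant (suc n / b) ([1+n]/b≤n n) ≤-refl)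

  digitSum-< : ∀ {n} → n < b → digitSum b n ≡ n
  digitSum-< {n} n<b = begin
    digitSum b n                   ≡⟨ digitSum-step n ⟩
    n % b + digitSum b (n / b)     ≡⟨ cong₂ _+_ (m<n⇒m%n≡m n<b) (cong (digitSum b) (m<n⇒m/n≡0 n<b)) ⟩
    n + 0                          ≡⟨ +-identityʳ n ⟩
    n                              ∎
    where open ≡-Reasoning

  digitSum-b^L+ : ∀ L {y} → y < b ^ L → digitSum b (b ^ L + y) ≡ suc (digitSum b y)
  digitSum-b^L+ zero    {zero}  _         = digitSum-< {1} (s≤s (s≤s z≤n))
  digitSum-b^L+ zero    {suc y} (s≤s ())
  digitSum-b^L+ (suc L) {y}    y<b^[1+L] = begin
    digitSum b (b ^ suc L + y)                             ≡⟨ cong (digitSum b) b^[1+L]+y≡y+b^L*b ⟩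
    digitSum b (y + b ^ L * b)                             ≡⟨ digitSum-step (y + b ^ L * b) ⟩
    (y + b ^ L * b) % b + digitSum b ((y + b ^ L * b) / b) ≡⟨ cong₂ _+_ ([m+kn]%n≡m%n y (b ^ L) b)
                                                                       (cong (digitSum b) y+b^L*b/b≡b^L+y/b) ⟩
    y % b + digitSum b (b ^ L + y / b)                     ≡⟨ cong (y % b +_) (digitSum-b^L+ L y/b<b^L) ⟩
    y % b + suc (digitSum b (y / b))                       ≡⟨ +-suc (y % b) _ ⟩
    suc (y % b + digitSum b (y / b))                       ≡⟨ cong suc (digitSum-step y) ⟨
    suc (digitSum b y)                                     ∎
    where
    open ≡-Reasoning
    y/b<b^L : y / b < b ^ L
    y/b<b^L = m<n*o⇒m/o<n (subst (y <_) (*-comm b (b ^ L)) y<b^[1+L])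
    b^[1+L]+y≡y+b^L*b : b ^ suc L + y ≡ y + b ^ L * b
    b^[1+L]+y≡y+b^L*b = trans (+-comm (b ^ suc L) y) (cong (y +_) (*-comm b (b ^ L)))
    y+b^L*b/b≡b^L+y/b : (y + b ^ L * b) / b ≡ b ^ L + y / b
    y+b^L*b/b≡b^L+y/b =
      trans (+-distrib-/-∣ʳ y (n∣m*n (b ^ L))) (trans (cong (y / b +_) (m*n/n≡m (b ^ L) b)) (+-comm (y / b) (b ^ L)))

  digitSum-b+ : ∀ {e} → e < b → digitSum b (b + e) ≡ suc e
  digitSum-b+ {e} e<b = begin
    digitSum b (b + e)        ≡⟨ cong (λ x → digitSum b (x + e)) (*-identityʳ b) ⟨
    digitSum b (b ^ 1 + e)    ≡⟨ digitSum-b^L+ 1 (subst (e <_) (sym (*-identityʳ b)) e<b) ⟩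
    suc (digitSum b e)        ≡⟨ cong suc (digitSum-< e<b) ⟩
    suc e                     ∎
    where open ≡-Reasoning

  digitSum-congruent : ∀ n → ∃[ t ] n ≡ digitSum b n + (b ∸ 1) * t
  digitSum-congruent = <-rec _ congruent
    where
    congruent : ∀ n → (∀ {m} → m < n → ∃[ t ] m ≡ digitSum b m + (b ∸ 1) * t) →
      ∃[ t ] n ≡ digitSum b n + (b ∸ 1) * t
    congruent zero    _   = 0 , sym (*-zeroʳ (suc k))
    congruent (suc n) rec with rec (m/n<m (suc n) b (s≤s (s≤s z≤n)))
    ... | t , q≡ = t + q , (begin
      suc n                                      ≡⟨ m≡m%n+[m/n]*n (suc n) b ⟩
      r + q * b                                  ≡⟨ split k r q ⟩
      r + q + q * suc k                          ≡⟨ cong (λ x → r + x + q * suc k) q≡ ⟩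
      r + (digitSum b q + suc k * t) + q * suc k ≡⟨ regroup k r (digitSum b q) t q ⟩
      r + digitSum b q + suc k * (t + q)         ≡⟨ cong (_+ suc k * (t + q)) (digitSum-step (suc n)) ⟨
      digitSum b (suc n) + suc k * (t + q)       ∎)
      where
      open ≡-Reasoning
      r q : ℕ
      r = suc n % b
      q = suc n / b
      split : ∀ k r q → r + q * suc (suc k) ≡ r + q + q * suc k
      split = solve-∀
      regroup : ∀ k r s t q → r + (s + suc k * t) + q * suc k ≡ r + s + suc k * (t + q)
      regroup = solve-∀

  ∣b∸1⇒∣n⇒∣digitSum : ∀ {d n} → d ∣ b ∸ 1 → d ∣ n → d ∣ digitSum b n
  ∣b∸1⇒∣n⇒∣digitSum {d} {n} d∣b∸1 d∣n with digitSum-congruent n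
  ... | t , n≡ = ∣m+n∣n⇒∣m (subst (d ∣_) n≡ d∣n) (∣m⇒∣m*n t d∣b∸1)

module AntiNivenProgressions (k : ℕ) where

  open DigitSum k

  ¬antiNivenProgression : ∀ {p} → Prime p → p ≢ 2 → p ∣ b ∸ 1 → ∀ n → ¬ (∀ j → j < p → AntiNiven b (n + 2 * j))
  ¬antiNivenProgression pp p≢2 p∣b∸1 n antiNiven with ¬2∣⇒odd (prime≢2⇒¬2∣ pp p≢2)
  ... | a , refl with odd∣n+2j a n
  ...   | j , j<p , p∣n+2j =
    prime∤1 pp (subst (_ ∣_) (antiNiven j j<p) (gcd-greatest p∣n+2j (∣b∸1⇒∣n⇒∣digitSum p∣b∸1 p∣n+2j)))

  data AtMostTwoDigits : ℕ → Set where
    oneDigit  : ∀ {y} → y < b → AtMostTwoDigits y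
    twoDigits : ∀ {e} → e < b → AtMostTwoDigits (b + e)

  atMostTwoDigits : ∀ {y} → y < b + b → AtMostTwoDigits y
  atMostTwoDigits {y} y<b+b with y <? b
  ... | yes y<b = oneDigit y<b
  ... | no  y≮b = subst AtMostTwoDigits b+e≡y (twoDigits (+-cancelˡ-< b _ _ (subst (_< b + b) (sym b+e≡y) y<b+b)))
    where
    b+e≡y : b + (y ∸ b) ≡ y
    b+e≡y = m+[n∸m]≡n (≮⇒≥ y≮b)

  digitSum≤b : ∀ {y} → AtMostTwoDigits y → digitSum b y ≤ b
  digitSum≤b (oneDigit y<b)  = subst (_≤ b) (sym (digitSum-< y<b)) (<⇒≤ y<b)
  digitSum≤b (twoDigits e<b) = subst (_≤ b) (sym (digitSum-b+ e<b)) e<b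

  -- Offsets y for which b ^ (1 + K) + y is b-anti-Niven whenever b ^ K is idempotent modulo all d ≤ b + 1.
  GoodOffset : ℕ → Set
  GoodOffset y = y < b + b × Coprime (suc y) (b ∸ 1) × (∀ e → y ≡ b + e → ¬ 2 ∣ e)

  goodOffset⇒prime∣1+digitSum⇒⊥ : ∀ {y q} → GoodOffset y → Prime q → q ∣ suc (digitSum b y) →
    ¬ ((q ∣ b × q ∣ y) ⊎ q ∣ b + y)
  goodOffset⇒prime∣1+digitSum⇒⊥ {y} {q} (y<b+b , coprime , odd) pq q∣d with atMostTwoDigits y<b+b
  ... | oneDigit y<b = [ (λ (_ , q∣y) → prime∤1 pq (∣m+n∣n⇒∣m q∣1+y q∣y)) , q∤b+y ]′
    where
    q∣1+y : q ∣ suc y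
    q∣1+y = subst (λ x → q ∣ suc x) (digitSum-< y<b) q∣d
    b+y≡1+y+[b∸1] : ∀ k y → 2 + k + y ≡ suc y + suc k
    b+y≡1+y+[b∸1] = solve-∀
    q∤b+y : ¬ q ∣ b + y
    q∤b+y q∣b+y =
      coprime∧prime∣⇒∤ coprime pq q∣1+y (∣m+n∣m⇒∣n (subst (q ∣_) (b+y≡1+y+[b∸1] k y) q∣b+y) q∣1+y)
  ... | twoDigits {e} e<b =
    [ (λ (q∣b , q∣b+e) → q∤2 (∣m+n∣n⇒∣m q∣2+e (∣m+n∣m⇒∣n q∣b+e q∣b))) , q∤2b+e ]′
    where
    q∣2+e : q ∣ 2 + e
    q∣2+e = subst (λ x → q ∣ suc x) (digitSum-b+ e<b) q∣d
    q∤2 : ¬ q ∣ 2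
    q∤2 q∣2 with prime∣2⇒≡2 pq q∣2
    ... | refl = odd e refl (∣m+n∣m⇒∣n q∣2+e q∣2)
    2b+e≡2+e+2[b∸1] : ∀ k e → 2 + k + (2 + k + e) ≡ 2 + e + 2 * suc k
    2b+e≡2+e+2[b∸1] = solve-∀
    1+b+e≡2+e+[b∸1] : ∀ k e → suc (2 + k + e) ≡ 2 + e + suc k
    1+b+e≡2+e+[b∸1] = solve-∀
    q∤2b+e : ¬ q ∣ b + (b + e)
    q∤2b+e q∣2b+e
      with euclidsLemma 2 (suc k) pq (∣m+n∣m⇒∣n (subst (q ∣_) (2b+e≡2+e+2[b∸1] k e) q∣2b+e) q∣2+e)
    ... | inj₁ q∣2   = q∤2 q∣2
    ... | inj₂ q∣b∸1 =
      coprime∧prime∣⇒∤ coprime pq (subst (q ∣_) (sym (1+b+e≡2+e+[b∸1] k e)) (∣m∣n⇒∣m+n q∣2+e q∣b∸1)) q∣b∸1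

  b+b≤b^[1+K] : ∀ {K} → 1 ≤ K → b + b ≤ b ^ suc K
  b+b≤b^[1+K] {K} 1≤K = ≤-trans (+-monoʳ-≤ b (m≤m+n b (k * b))) (*-monoʳ-≤ b b≤b^K)
    where
    b≤b^K : b ≤ b ^ K
    b≤b^K = subst (_≤ b ^ K) (*-identityʳ b) (^-monoʳ-≤ b 1≤K)

  antiNiven-b^[1+K]+ : ∀ {K y} → 1 ≤ K → (∀ {d} → 0 < d → d ≤ suc b → d ∣ b ^ K * (b ^ K ∸ 1)) →
    GoodOffset y → AntiNiven b (b ^ suc K + y)
  antiNiven-b^[1+K]+ {K} {y} 1≤K idempotent good@(y<b+b , _) = begin
    gcd m (digitSum b m)       ≡⟨ cong (gcd m) (digitSum-b^L+ (suc K) (<-≤-trans y<b+b (b+b≤b^[1+K] 1≤K))) ⟩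
    gcd m (suc (digitSum b y)) ≡⟨ coprime⇒gcd≡1 (noCommonPrime⇒coprime noCommonPrime) ⟩
    1                          ∎
    where
    open ≡-Reasoning
    m : ℕ
    m = b ^ suc K + y
    noCommonPrime : ∀ {q} → Prime q → q ∣ m → q ∣ suc (digitSum b y) → ⊥
    noCommonPrime {q} pq q∣m q∣d =
      goodOffset⇒prime∣1+digitSum⇒⊥ good pq q∣d (map₁ q∣b×q∣y (euclidsLemma (b ^ K) (b + y) pq q∣b^K[b+y]))
      where
      q∣b^K[b+y] : q ∣ b ^ K * (b + y)
      q∣b^K[b+y] = ∣x[x∸1]∧∣bx+y⇒∣x[b+y] (b ^ K) b y
                     (∣-trans q∣d (idempotent z<s (s≤s (digitSum≤b (atMostTwoDigits y<b+b))))) q∣m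
      q∣b×q∣y : q ∣ b ^ K → q ∣ b × q ∣ y
      q∣b×q∣y q∣b^K = prime∣^⇒∣ b K pq q∣b^K , ∣m+n∣m⇒∣n q∣m (∣n⇒∣m*n b q∣b^K)

  antiNivenProgressions : ∀ {c} → ∃[ y ] (∀ j → j < c → GoodOffset (y + 2 * j)) →
    ∀ N → ∃[ n ] N < n × (∀ j → j < c → AntiNiven b (n + 2 * j))
  -- A `with` on the exponent would make Agda normalise the pigeonhole witness, which exhausts memory.
  antiNivenProgressions {c} (y , good) N = fromIdempotent (idempotentPower≤ b (suc b) (suc N))
    where
    fromIdempotent : ∃[ K ] N < K × (∀ {d} → 0 < d → d ≤ suc b → d ∣ b ^ K * (b ^ K ∸ 1)) →
      ∃[ n ] N < n × (∀ j → j < c → AntiNiven b (n + 2 * j))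
    fromIdempotent (K , N<K , idempotent) = b ^ suc K + y , N<n , antiNiven
      where
      N<n : N < b ^ suc K + y
      N<n = <-≤-trans (<-trans N<K (n<1+n K)) (≤-trans (<⇒≤ (n<m^n (s≤s (s≤s z≤n)) (suc K))) (m≤m+n _ y))
      antiNiven : ∀ j → j < c → AntiNiven b (b ^ suc K + y + 2 * j)
      antiNiven j j<c = subst (AntiNiven b) (sym (+-assoc (b ^ suc K) y (2 * j)))
                          (antiNiven-b^[1+K]+ (≤-trans (s≤s z≤n) N<K) idempotent (good j j<c))

  oddPartOffset-good : ∀ {w z j} → w + z ≡ b ∸ 1 → ¬ 2 ∣ w → (∀ {q} → Prime q → q ≢ 2 → q ∣ b ∸ 1 → q ∣ w) →
    (∀ {q} → Prime q → q ∣ w → suc j < q) → j < w → GoodOffset (suc z + 2 * j)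
  oddPartOffset-good {w} {z} {j} w+z≡b∸1 2∤w oddPrime∣w j<primes j<w =
    below , noCommonPrime⇒coprime noCommonPrime , oddLowDigit
    where
    open ≡-Reasoning
    b≡1+w+z : b ≡ suc (w + z)
    b≡1+w+z = cong suc (sym w+z≡b∸1)
    doubled : ∀ w z → suc (w + z) + suc (w + z) ≡ suc z + 2 * w + suc z
    doubled = solve-∀
    below : suc z + 2 * j < b + b
    below = <-≤-trans (+-monoʳ-< (suc z) (*-monoʳ-< 2 j<w))
              (subst (suc z + 2 * w ≤_) (trans (sym (doubled w z)) (cong (λ x → x + x) (sym b≡1+w+z))) (m≤m+n _ (suc z)))
    reassociate : ∀ w z e → suc (w + z) + e ≡ suc z + (w + e)
    reassociate = solve-∀
    oddLowDigit : ∀ e → suc z + 2 * j ≡ b + e → ¬ 2 ∣ e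
    oddLowDigit e eq 2∣e = 2∤w (∣m+n∣n⇒∣m (subst (2 ∣_) 2j≡w+e (m∣m*n j)) 2∣e)
      where
      2j≡w+e : 2 * j ≡ w + e
      2j≡w+e = +-cancelˡ-≡ (suc z) _ _ (trans eq (trans (cong (_+ e) b≡1+w+z) (reassociate w z e)))
    balance : ∀ w z j → suc (suc z + 2 * j) + w ≡ w + z + 2 * suc j
    balance = solve-∀
    noCommonPrime : ∀ {q} → Prime q → q ∣ suc (suc z + 2 * j) → q ∣ b ∸ 1 → ⊥
    noCommonPrime {q} pq q∣y+1 q∣b∸1 with q ≟ 2
    ... | yes refl =
      2∤w (∣m+n∣m⇒∣n (subst (2 ∣_) (sym (balance w z j)) (∣m∣n⇒∣m+n 2∣w+z (m∣m*n (suc j)))) q∣y+1)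
      where
      2∣w+z : 2 ∣ w + z
      2∣w+z = subst (2 ∣_) (sym w+z≡b∸1) q∣b∸1
    ... | no q≢2 = [ (λ q∣2 → q≢2 (prime∣2⇒≡2 pq q∣2)) , (λ q∣1+j → <⇒≱ (j<primes pq q∣w) (∣⇒≤ q∣1+j)) ]′
                     (euclidsLemma 2 (suc j) pq q∣2[1+j])
      where
      q∣w : q ∣ w
      q∣w = oddPrime∣w pq q≢2 q∣b∸1
      q∣2[1+j] : q ∣ 2 * suc j
      q∣2[1+j] = ∣m+n∣m⇒∣n (subst (q ∣_) (balance w z j) (∣m∣n⇒∣m+n q∣y+1 q∣w))
                             (subst (q ∣_) (sym w+z≡b∸1) q∣b∸1)

  oddPartOffsets : ∀ {p} → Prime p → p ≢ 2 → p ∣ b ∸ 1 → (∀ q → Prime q → q ≢ 2 → q ∣ b ∸ 1 → p ≤ q) →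
    ∃[ y ] (∀ j → j < p ∸ 1 → GoodOffset (y + 2 * j))
  oddPartOffsets {p} pp p≢2 p∣b∸1 minimal with oddDecomposition (b ∸ 1) z<s
  ... | s , w , b∸1≡2^s*w , 2∤w = suc (b ∸ 1 ∸ w) , λ j j<p∸1 →
    oddPartOffset-good w+z≡b∸1 2∤w oddPrime∣w (j<oddPrimes j<p∸1)
                       (<-≤-trans (<-trans (n<1+n j) (2+j≤p j<p∸1)) p≤w)
    where
    oddPrime∣w : ∀ {q} → Prime q → q ≢ 2 → q ∣ b ∸ 1 → q ∣ w
    oddPrime∣w {q} pq q≢2 q∣b∸1 = oddPrime∣2^s*w⇒∣w {s = s} pq q≢2 (subst (q ∣_) b∸1≡2^s*w q∣b∸1)
    w∣b∸1 : w ∣ b ∸ 1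
    w∣b∸1 = subst (w ∣_) (sym b∸1≡2^s*w) (n∣m*n (2 ^ s))
    w+z≡b∸1 : w + (b ∸ 1 ∸ w) ≡ b ∸ 1
    w+z≡b∸1 = m+[n∸m]≡n (∣⇒≤ w∣b∸1)
    p≤w : p ≤ w
    p≤w = ∣⇒≤ {{≢-nonZero (λ { refl → 2∤w (2 ∣0) })}} (oddPrime∣w pp p≢2 p∣b∸1)
    2+j≤p : ∀ {j} → j < p ∸ 1 → 2 + j ≤ p
    2+j≤p j<p∸1 = subst (_ ≤_) (m+[n∸m]≡n (<⇒≤ (prime≥2 pp))) (s≤s j<p∸1)
    j<oddPrimes : ∀ {j} → j < p ∸ 1 → ∀ {q} → Prime q → q ∣ w → suc j < q
    j<oddPrimes j<p∸1 {q} pq q∣w = ≤-trans (2+j≤p j<p∸1) (minimal q pq q≢2 (∣-trans q∣w w∣b∸1))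
      where
      q≢2 : q ≢ 2
      q≢2 refl = 2∤w q∣w

theorem3p3 : (b : ℕ) → 2 < b → (∀ (r : ℕ) → b ≢ 2 ^ r + 1) →
    (p : ℕ) → Prime p → p ≢ 2 → p ∣ b ∸ 1 →
    (∀ (q : ℕ) → Prime q → q ≢ 2 → q ∣ b ∸ 1 → p ≤ q) →
    -- a progression of length p - 1 exists
    (∃[ n ] (1 ≤ n × (∀ (j : ℕ) → j < p ∸ 1 → AntiNiven b (n + 2 * j))))
    -- no progression of length p exists
    × (∀ (n : ℕ) → 1 ≤ n → ¬ (∀ (j : ℕ) → j < p → AntiNiven b (n + 2 * j)))
    -- infinitely many starting points n for length p - 1
    × (∀ (N : ℕ) → ∃[ n ] (N < n × (∀ (j : ℕ) → j < p ∸ 1 → AntiNiven b (n + 2 * j))))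
theorem3p3 (suc (suc (suc k))) (s≤s (s≤s (s≤s z≤n))) _ p pp p≢2 p∣b∸1 minimal =
  progressions 0 , (λ n _ → ¬antiNivenProgression pp p≢2 p∣b∸1 n) , progressions
  where
  open DigitSum (suc k) using (b)
  open AntiNivenProgressions (suc k)
  progressions : ∀ N → ∃[ n ] (N < n × (∀ j → j < p ∸ 1 → AntiNiven b (n + 2 * j)))
  progressions = antiNivenProgressions (oddPartOffsets pp p≢2 p∣b∸1 minimal)
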